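{- For all integers $n,r\ge 1$, $$|B_x(n,r)|\ \ge\ 1+\sum_{i=1}^{n}\binom{n}{i}\binom{i+2^r-2}{i}\Big/ r!.$$
   Context: Let $I$ (left vertices) and $O$ (right vertices) be disjoint finite sets with $|I|=n$ and $|O|=r$. An $(n,r)$-bipartite graph is $G=(I\oplus O,E)$ with edge set $E\subseteq I\times O$. The connected domain $I_c(G)$ is the set of vertices of $I$ with nonzero degree in $G$. Two $(n,r)$-bipartite graphs $G_1=(I\oplus O,E_1)$ and $G_2=(I\oplus O,E_2)$ are left-set-labeled equivalent if there exist bijections $\alpha:I\to I$ and $\beta:O\to O$ such that for all $x\in I,y\in O$, $(x,y)\in E_1$ iff $(\alpha(x),\beta(y))\in E_2$, and moreover $I_c(G_1)=I_c(G_2)$. $B_x(n,r)$ denotes the set of equivalence classes of $(n,r)$-bipartite graphs under left-set-labeled equivalence. -}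

module Defs where

open import Data.Nat using (ℕ; zero; suc; _+_; _*_; _∸_; _^_; _!)
open import Data.Nat.Properties using (_!≢0)
open import Data.Nat.Combinatorics using (_C_)
open import Data.Fin using (Fin)
open import Data.Bool using (Bool; true)
open import Data.Product using (Σ; ∃-syntax; _×_)
open import Data.Integer using (+_)
open import Data.Rational using (ℚ; _/_; 1ℚ)
import Data.Rational as ℚ
open import Function.Bundles using (_↔_; Inverse; _⇔_)
open import Relation.Binary.PropositionalEquality using (_≡_)

-- An (n,r)-bipartite graph with left vertices I = Fin n, right vertices O = Fin r;
-- the edge set E ⊆ I × O is given by its (decidable) characteristic function.
BipGraph : ℕ → ℕ → Set
BipGraph n r = Fin n → Fin r → Bool

InConnDomain : ∀ {n r} → BipGraph n r → Fin n → Set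
InConnDomain G x = ∃[ y ] (G x y ≡ true)

record LSLEquiv {n r : ℕ} (G₁ G₂ : BipGraph n r) : Set where
  field
    α : Fin n ↔ Fin n
    β : Fin r ↔ Fin r
    edges : ∀ x y → G₁ x y ≡ G₂ (Inverse.to α x) (Inverse.to β y)
    domain : ∀ x → InConnDomain G₁ x ⇔ InConnDomain G₂ x

-- |B_x(n,r)| ≥ m : there are m pairwise inequivalent (n,r)-bipartite graphs,
-- i.e. an injection Fin m → B_x(n,r) (the quotient by LSLEquiv).
AtLeastClasses : ℕ → ℕ → ℕ → Set
AtLeastClasses n r m =
  Σ (Fin m → BipGraph n r) λ f → ∀ i j → LSLEquiv (f i) (f j) → i ≡ j

-- Σ_{i=1}^{n} C(n,i) C(i+2^r-2, i)   (for r ≥ 1, 2^r - 2 is a natural number)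
termB : ℕ → ℕ → ℕ → ℕ
termB n r i = (n C i) * ((i + (2 ^ r ∸ 2)) C i)

sumB : ℕ → ℕ → ℕ → ℕ
sumB n r zero = 0
sumB n r (suc k) = sumB n r k + termB n r (suc k)

boundB : ℕ → ℕ → ℚ
boundB n r = 1ℚ ℚ.+ ((+ sumB n r n) / (r !)) {{r !≢0}}

-- For a graph G write invariant G for the pair (I_c(G), c), where c records for every nonempty
-- t ⊆ O how many rows of G are equal to t. If G and H are left-set-labeled equivalent via
-- β : O → O, then invariant H is invariant G with the counts relabelled by β, so the invariants
-- of the graphs equivalent to G lie in a list of length r!. Conversely every pair (S, c) whose
-- counts add up to |S| is the invariant of a graph: give the vertices of S rows t, c_t times
-- each. For 1 ≤ |S| ≤ n there are Σᵢ C(n,i) C(i+2^r-2,i) such pairs (c is a weak composition of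
-- |S| into 2^r - 1 parts). Selecting greedily those pairs not yet covered by the invariants of an
-- already selected graph gives at least that number divided by r! pairwise inequivalent graphs,
-- and the empty graph is inequivalent to all of them.
module Submission where

open import Defs

open import Data.Bool as Bool using (Bool; true; false; if_then_else_)
open import Data.Empty using (⊥-elim)
open import Data.Fin using (Fin; zero; suc; punchIn; punchOut)
open import Data.Fin.Properties using (any?; punchIn-punchOut; punchOut-injective)
  renaming (suc-injective to Fin-suc-injective)
open import Data.Fin.Subset using (Subset; inside; outside; ∣_∣; Nonempty) renaming (⊥ to ∅)
open import Data.Fin.Subset.Properties using (nonempty?; ∉⊥; ∣⊥∣≡0)
open import Data.Integer as ℤ using (+_; +≤+)
import Data.Integer.Properties as ℤ
open import Data.List as List
  using (List; []; _∷_; _++_; map; length; replicate; foldr; concatMap; allFin;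
         cartesianProductWith; cartesianProduct)
open import Data.List.Properties as List
  using (length-++; length-map; length-replicate; length-removeAt′; length-tabulate; map-cong-local)
open import Data.List.Membership.Propositional using (_∈_; _∉_)
open import Data.List.Membership.Propositional.Properties
  using (∈-map⁺; ∈-map⁻; ∈-cartesianProductWith⁺; ∈-cartesianProduct⁻; ∈-allFin; ∈-lookup)
open import Data.List.Relation.Binary.Disjoint.Propositional using (Disjoint)
open import Data.List.Relation.Binary.Subset.Propositional using (_⊆_)
open import Data.List.Relation.Unary.All as All using (All; []; _∷_)
import Data.List.Relation.Unary.All.Properties as All
open import Data.List.Relation.Unary.AllPairs as AllPairs using (AllPairs; []; _∷_)
import Data.List.Relation.Unary.AllPairs.Properties as AllPairs
open import Data.List.Relation.Unary.Any as Any using (Any; here; there; _─_; index)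
open import Data.List.Relation.Unary.Any.Properties using (concatMap⁺)
open import Data.List.Relation.Unary.Unique.Propositional using (Unique)
import Data.List.Relation.Unary.Unique.Propositional.Properties as Unique
open import Data.Nat as ℕ using (ℕ; zero; suc; _+_; _*_; _∸_; _^_; _!; _≤_; NonZero; z≤n; s≤s)
open import Data.Nat.Combinatorics using (_C_; nCk+nC[k+1]≡[n+1]C[k+1]; nCn≡1)
open import Data.Nat.ListAction using (sum)
open import Data.Nat.Properties as ℕ
  using (_!≢0; +-assoc; +-comm; +-suc; +-identityʳ; *-suc; *-comm; suc-injective; 1+n≰n;
         ≤-reflexive; +-mono-≤; +-monoʳ-≤; m^n>0; +-0-commutativeMonoid; module ≤-Reasoning)
open import Algebra.Properties.CommutativeMonoid.Sum +-0-commutativeMonoid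
  using (sum-permute; sum-cong-≗) renaming (sum to ∑)
open import Data.Product using (_×_; _,_; proj₁; proj₂; ∃-syntax)
import Data.Product.Properties as Product
open import Data.Rational as ℚ using (_/_; 1ℚ; toℚᵘ)
import Data.Rational.Properties as ℚ
open import Data.Rational.Unnormalised as ℚᵘ using (mkℚᵘ; *≤*)
import Data.Rational.Unnormalised.Properties as ℚᵘ
open import Data.Vec as Vec using (Vec; []; _∷_; lookup; tabulate; toList)
open import Data.Vec.Properties
  using (≡-dec; ∷-injectiveʳ; tabulate-cong; tabulate∘lookup; lookup∘tabulate; []=⇒lookup; lookup⇒[]=)
open import Function using (_∘_; id)
open import Function.Bundles using (Inverse; Injection; Equivalence; _⇔_; mk⇔)
open import Function.Properties.Inverse using (↔-refl; ↔-sym; Inverse⇒Injection)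
open import Relation.Binary.Definitions using (DecidableEquality; Symmetric)
open import Relation.Binary.PropositionalEquality
open import Relation.Nullary using (¬_; Dec; yes; no; does)
open import Relation.Nullary.Decidable using (dec-true; dec-false)

private
  variable
    A B D : Set
    n r : ℕ

length-cartesianProductWith : ∀ (f : A → B → D) xs ys →
  length (cartesianProductWith f xs ys) ≡ length xs * length ys
length-cartesianProductWith f []       ys = refl
length-cartesianProductWith f (x ∷ xs) ys = begin
  length (map (f x) ys ++ cartesianProductWith f xs ys)         ≡⟨ length-++ (map (f x) ys) ⟩
  length (map (f x) ys) + length (cartesianProductWith f xs ys) ≡⟨ cong₂ _+_ (length-map (f x) ys)
                                                                      (length-cartesianProductWith f xs ys) ⟩
  length ys + length xs * length ys                             ∎
  where open ≡-Reasoning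

map-disjoint : ∀ {f : A → D} {g : B → D} → (∀ x y → f x ≢ g y) →
  ∀ {xs ys} → Disjoint (map f xs) (map g ys)
map-disjoint {f = f} {g} f≢g (v∈fxs , v∈gys)
  with x , _ , refl ← ∈-map⁻ f v∈fxs | y , _ , fx≡gy ← ∈-map⁻ g v∈gys = f≢g x y fx≡gy

All-disjoint : ∀ {P : A → Set} {xs ys} → All P xs → All (¬_ ∘ P) ys → Disjoint xs ys
All-disjoint Pxs ¬Pys (v∈xs , v∈ys) = All.lookup ¬Pys v∈ys (All.lookup Pxs v∈xs)

∈-─ : ∀ {x y : A} {ys} (x∈ys : x ∈ ys) → y ∈ ys → y ≢ x → y ∈ (ys ─ x∈ys)
∈-─ (here refl)  (here refl)  y≢x = ⊥-elim (y≢x refl)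
∈-─ (here _)     (there y∈ys) _   = y∈ys
∈-─ (there _)    (here y≡z)   _   = here y≡z
∈-─ (there x∈ys) (there y∈ys) y≢x = there (∈-─ x∈ys y∈ys y≢x)

Unique-⊆⇒length-≤ : ∀ {xs ys : List A} → Unique xs → xs ⊆ ys → length xs ≤ length ys
Unique-⊆⇒length-≤ {xs = []}     _             _     = z≤n
Unique-⊆⇒length-≤ {xs = x ∷ xs} {ys} (x≢xs ∷ uniq) xs⊆ys = begin
  suc (length xs)          ≤⟨ s≤s (Unique-⊆⇒length-≤ uniq xs⊆ys─x) ⟩
  suc (length (ys ─ x∈ys)) ≡⟨ sym (length-removeAt′ ys (index x∈ys)) ⟩
  length ys                ∎
  where
  open ≤-Reasoning
  x∈ys = xs⊆ys (here refl)
  xs⊆ys─x : xs ⊆ (ys ─ x∈ys)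
  xs⊆ys─x y∈xs = ∈-─ x∈ys (xs⊆ys (there y∈xs)) (λ y≡x → All.lookup x≢xs y∈xs (sym y≡x))

length-concatMap-≤ : ∀ (T : A → List B) {K} → (∀ x → length (T x) ≤ K) →
  ∀ xs → length (concatMap T xs) ≤ K * length xs
length-concatMap-≤ T     T≤K []       = z≤n
length-concatMap-≤ T {K} T≤K (x ∷ xs) = begin
  length (T x ++ concatMap T xs)         ≡⟨ length-++ (T x) ⟩
  length (T x) + length (concatMap T xs) ≤⟨ +-mono-≤ (T≤K x) (length-concatMap-≤ T T≤K xs) ⟩
  K + K * length xs                      ≡⟨ sym (*-suc K (length xs)) ⟩
  K * suc (length xs)                    ∎
  where open ≤-Reasoning

-- Read f x ∈ T z as "x may be identified with z": when each T z is short and f is injective on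
-- xs, the pairwise separated list select xs must be long.
module GreedyCover {A B : Set} (_≟_ : DecidableEquality B) (f : A → B) (T : A → List B) where

  open import Data.List.Membership.DecPropositional _≟_ using (_∈?_)

  CoveredBy : List A → A → Set
  CoveredBy zs x = Any (λ z → f x ∈ T z) zs

  Separated : A → A → Set
  Separated a b = f a ∉ T b

  covered? : ∀ zs x → Dec (CoveredBy zs x)
  covered? zs x = Any.any? (λ z → f x ∈? T z) zs

  keepIfUncovered : A → List A → List A
  keepIfUncovered x zs with covered? zs x
  ... | yes _ = zs
  ... | no  _ = x ∷ zs

  select : List A → List A
  select = foldr keepIfUncovered []

  keepIfUncovered-⊆ : ∀ x zs → keepIfUncovered x zs ⊆ x ∷ zs
  keepIfUncovered-⊆ x zs with covered? zs x
  ... | yes _ = there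
  ... | no  _ = id

  keepIfUncovered-separated : ∀ x {zs} → AllPairs Separated zs → AllPairs Separated (keepIfUncovered x zs)
  keepIfUncovered-separated x {zs} separated with covered? zs x
  ... | yes _         = separated
  ... | no  uncovered = All.¬Any⇒All¬ zs uncovered ∷ separated

  keepIfUncovered-covers : ∀ x zs → f x ∈ T x → CoveredBy (keepIfUncovered x zs) x
  keepIfUncovered-covers x zs fx∈Tx with covered? zs x
  ... | yes covered = covered
  ... | no  _       = here fx∈Tx

  keepIfUncovered-mono : ∀ x zs {y} → CoveredBy zs y → CoveredBy (keepIfUncovered x zs) y
  keepIfUncovered-mono x zs with covered? zs x
  ... | yes _ = id
  ... | no  _ = there

  select-⊆ : ∀ xs → select xs ⊆ xs
  select-⊆ [] ()
  select-⊆ (x ∷ xs) z∈ with keepIfUncovered-⊆ x (select xs) z∈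
  ... | here z≡x = here z≡x
  ... | there z∈ = there (select-⊆ xs z∈)

  select-separated : ∀ xs → AllPairs Separated (select xs)
  select-separated []       = []
  select-separated (x ∷ xs) = keepIfUncovered-separated x (select-separated xs)

  module _ (reflexive : ∀ x → f x ∈ T x) where

    select-covers : ∀ xs {x} → x ∈ xs → CoveredBy (select xs) x
    select-covers (x ∷ xs) (here refl) = keepIfUncovered-covers x (select xs) (reflexive x)
    select-covers (x ∷ xs) (there y∈xs) = keepIfUncovered-mono x (select xs) (select-covers xs y∈xs)

    length≤*length-select : ∀ {K} → (∀ x → length (T x) ≤ K) → ∀ xs → Unique (map f xs) →
      length xs ≤ K * length (select xs)
    length≤*length-select {K} T≤K xs uniq = begin
      length xs                        ≡⟨ sym (length-map f xs) ⟩
      length (map f xs)                ≤⟨ Unique-⊆⇒length-≤ uniq fxs⊆ ⟩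
      length (concatMap T (select xs)) ≤⟨ length-concatMap-≤ T T≤K (select xs) ⟩
      K * length (select xs)           ∎
      where
      open ≤-Reasoning
      fxs⊆ : map f xs ⊆ concatMap T (select xs)
      fxs⊆ v∈
        with x , x∈xs , refl ← ∈-map⁻ f v∈ = concatMap⁺ T (select-covers xs x∈xs)

AllPairs-lookup-injective : ∀ {R : A → A → Set} → Symmetric R → ∀ {xs} →
  AllPairs (λ a b → ¬ R a b) xs → ∀ i j → R (List.lookup xs i) (List.lookup xs j) → i ≡ j
AllPairs-lookup-injective sym′ (_ ∷ _)   zero    zero    _ = refl
AllPairs-lookup-injective sym′ (¬R ∷ _)  zero    (suc j) R = ⊥-elim (All.lookup ¬R (∈-lookup j) R)
AllPairs-lookup-injective sym′ (¬R ∷ _)  (suc i) zero    R = ⊥-elim (All.lookup ¬R (∈-lookup i) (sym′ R))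
AllPairs-lookup-injective sym′ (_ ∷ ¬Rs) (suc i) (suc j) R =
  cong suc (AllPairs-lookup-injective sym′ ¬Rs i j R)

consPerm : ∀ {r} → Fin (suc r) → (Fin r → Fin r) → Fin (suc r) → Fin (suc r)
consPerm i p zero    = i
consPerm i p (suc x) = punchIn i (p x)

perms : ∀ r → List (Fin r → Fin r)
perms zero    = id ∷ []
perms (suc r) = cartesianProductWith consPerm (allFin (suc r)) (perms r)

length-perms : ∀ r → length (perms r) ≡ r !
length-perms zero    = refl
length-perms (suc r) = trans (length-cartesianProductWith consPerm (allFin (suc r)) (perms r))
                             (cong₂ _*_ (length-tabulate {n = suc r} id) (length-perms r))

perms-complete : ∀ {r} (f : Fin r → Fin r) → (∀ {x y} → f x ≡ f y → x ≡ y) →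
  ∃[ p ] p ∈ perms r × p ≗ f
perms-complete {zero}  f _ = id , here refl , λ ()
perms-complete {suc r} f injective =
  consPerm (f zero) p , ∈-cartesianProductWith⁺ consPerm (∈-allFin (f zero)) p∈perms , consPerm≗f
  where
  f0≢f[1+x] : ∀ x → f zero ≢ f (suc x)
  f0≢f[1+x] x eq with () ← injective eq
  g : Fin r → Fin r
  g x = punchOut (f0≢f[1+x] x)
  g-injective : ∀ {x y} → g x ≡ g y → x ≡ y
  g-injective eq = Fin-suc-injective (injective (punchOut-injective (f0≢f[1+x] _) (f0≢f[1+x] _) eq))
  ih : ∃[ p ] p ∈ perms r × p ≗ g
  ih = perms-complete g g-injective
  p = proj₁ ih
  p∈perms = proj₁ (proj₂ ih)
  p≗g = proj₂ (proj₂ ih)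
  consPerm≗f : consPerm (f zero) p ≗ f
  consPerm≗f zero    = refl
  consPerm≗f (suc x) = trans (cong (punchIn (f zero)) (p≗g x)) (punchIn-punchOut (f0≢f[1+x] x))

length-map-++ : ∀ (f : A → D) (g : B → D) xs ys →
  length (map f xs ++ map g ys) ≡ length xs + length ys
length-map-++ f g xs ys = trans (length-++ (map f xs)) (cong₂ _+_ (length-map f xs) (length-map g ys))

Unique-byHead : ∀ {n} {xs ys : List (Subset n)} → Unique xs → Unique ys →
  Unique (map (inside ∷_) xs ++ map (outside ∷_) ys)
Unique-byHead uxs uys = Unique.++⁺ (Unique.map⁺ ∷-injectiveʳ uxs) (Unique.map⁺ ∷-injectiveʳ uys)
  (map-disjoint λ _ _ ())

subsetsOfSize : ∀ n → ℕ → List (Subset n)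
subsetsOfSize zero    zero    = [] ∷ []
subsetsOfSize zero    (suc i) = []
subsetsOfSize (suc n) zero    = map (outside ∷_) (subsetsOfSize n zero)
subsetsOfSize (suc n) (suc i) =
  map (inside ∷_) (subsetsOfSize n i) ++ map (outside ∷_) (subsetsOfSize n (suc i))

length-subsetsOfSize : ∀ n i → length (subsetsOfSize n i) ≡ n C i
length-subsetsOfSize zero    zero    = refl
length-subsetsOfSize zero    (suc i) = refl
length-subsetsOfSize (suc n) zero    =
  trans (length-map (outside ∷_) (subsetsOfSize n zero)) (length-subsetsOfSize n zero)
length-subsetsOfSize (suc n) (suc i) = begin
  length (subsetsOfSize (suc n) (suc i))
    ≡⟨ length-map-++ (inside ∷_) (outside ∷_) (subsetsOfSize n i) (subsetsOfSize n (suc i)) ⟩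
  length (subsetsOfSize n i) + length (subsetsOfSize n (suc i))
    ≡⟨ cong₂ _+_ (length-subsetsOfSize n i) (length-subsetsOfSize n (suc i)) ⟩
  n C i + n C suc i
    ≡⟨ nCk+nC[k+1]≡[n+1]C[k+1] n i ⟩
  suc n C suc i
    ∎
  where open ≡-Reasoning

∣∣-subsetsOfSize : ∀ n i → All (λ S → ∣ S ∣ ≡ i) (subsetsOfSize n i)
∣∣-subsetsOfSize zero    zero    = refl ∷ []
∣∣-subsetsOfSize zero    (suc i) = []
∣∣-subsetsOfSize (suc n) zero    = All.map⁺ (∣∣-subsetsOfSize n zero)
∣∣-subsetsOfSize (suc n) (suc i) =
  All.++⁺ (All.map⁺ (All.map (cong suc) (∣∣-subsetsOfSize n i))) (All.map⁺ (∣∣-subsetsOfSize n (suc i)))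

subsetsOfSize-unique : ∀ n i → Unique (subsetsOfSize n i)
subsetsOfSize-unique zero    zero    = [] ∷ []
subsetsOfSize-unique zero    (suc i) = []
subsetsOfSize-unique (suc n) zero    = Unique.map⁺ ∷-injectiveʳ (subsetsOfSize-unique n zero)
subsetsOfSize-unique (suc n) (suc i) =
  Unique-byHead (subsetsOfSize-unique n i) (subsetsOfSize-unique n (suc i))

allSubsets : ∀ r → List (Subset r)
allSubsets zero    = [] ∷ []
allSubsets (suc r) = map (inside ∷_) (allSubsets r) ++ map (outside ∷_) (allSubsets r)

nonemptySubsets : ∀ r → List (Subset r)
nonemptySubsets zero    = []
nonemptySubsets (suc r) = map (inside ∷_) (allSubsets r) ++ map (outside ∷_) (nonemptySubsets r)

length-allSubsets : ∀ r → length (allSubsets r) ≡ 2 ^ r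
length-allSubsets zero    = refl
length-allSubsets (suc r) = begin
  length (allSubsets (suc r))   ≡⟨ length-map-++ (inside ∷_) (outside ∷_) (allSubsets r) (allSubsets r) ⟩
  length (allSubsets r) + length (allSubsets r) ≡⟨ cong (λ m → m + m) (length-allSubsets r) ⟩
  2 ^ r + 2 ^ r                 ≡⟨ cong (λ m → 2 ^ r + m) (sym (+-identityʳ (2 ^ r))) ⟩
  2 ^ suc r                     ∎
  where open ≡-Reasoning

length-nonemptySubsets : ∀ r → suc (length (nonemptySubsets r)) ≡ 2 ^ r
length-nonemptySubsets zero    = refl
length-nonemptySubsets (suc r) = begin
  suc (length (nonemptySubsets (suc r)))
    ≡⟨ cong suc (length-map-++ (inside ∷_) (outside ∷_) (allSubsets r) (nonemptySubsets r)) ⟩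
  suc (length (allSubsets r) + length (nonemptySubsets r))
    ≡⟨ +-suc (length (allSubsets r)) _ ⟨
  length (allSubsets r) + suc (length (nonemptySubsets r))
    ≡⟨ cong₂ _+_ (length-allSubsets r) (length-nonemptySubsets r) ⟩
  2 ^ r + 2 ^ r
    ≡⟨ cong (λ m → 2 ^ r + m) (sym (+-identityʳ (2 ^ r))) ⟩
  2 ^ suc r
    ∎
  where open ≡-Reasoning

length-nonemptySubsets-suc : ∀ r → length (nonemptySubsets (suc r)) ≡ suc (2 ^ suc r ∸ 2)
length-nonemptySubsets-suc r
  with length (nonemptySubsets (suc r)) | length-nonemptySubsets (suc r)
... | zero  | 1≡2^[1+r]   = ⊥-elim (1+n≰n (subst (2 ≤_) (sym 1≡2^[1+r]) (ℕ.*-monoʳ-≤ 2 (m^n>0 2 r))))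
... | suc m | 2+m≡2^[1+r] = cong (λ x → suc (x ∸ 2)) 2+m≡2^[1+r]

allSubsets-unique : ∀ r → Unique (allSubsets r)
allSubsets-unique zero    = [] ∷ []
allSubsets-unique (suc r) = Unique-byHead (allSubsets-unique r) (allSubsets-unique r)

nonemptySubsets-unique : ∀ r → Unique (nonemptySubsets r)
nonemptySubsets-unique zero    = []
nonemptySubsets-unique (suc r) = Unique-byHead (allSubsets-unique r) (nonemptySubsets-unique r)

nonemptySubsets-nonempty : ∀ r → All Nonempty (nonemptySubsets r)
nonemptySubsets-nonempty zero    = []
nonemptySubsets-nonempty (suc r) = All.++⁺
  (All.map⁺ (All.universal (λ _ → zero , Vec.here) (allSubsets r)))
  (All.map⁺ (All.map (λ (y , y∈t) → suc y , Vec.there y∈t) (nonemptySubsets-nonempty r)))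

incrementHead : List ℕ → List ℕ
incrementHead []       = []
incrementHead (a ∷ as) = suc a ∷ as

-- Weak compositions of i into k + 1 parts.
compositions : ℕ → ℕ → List (List ℕ)
compositions i       zero    = (i ∷ []) ∷ []
compositions zero    (suc k) = map (0 ∷_) (compositions zero k)
compositions (suc i) (suc k) =
  map (0 ∷_) (compositions (suc i) k) ++ map incrementHead (compositions i (suc k))

length-compositions : ∀ i k → length (compositions i k) ≡ (i + k) C i
length-compositions i       zero    = trans (sym (nCn≡1 i)) (cong (_C i) (sym (+-identityʳ i)))
length-compositions zero    (suc k) =
  trans (length-map (0 ∷_) (compositions zero k)) (length-compositions zero k)
length-compositions (suc i) (suc k) = begin
  length (compositions (suc i) (suc k))
    ≡⟨ length-map-++ (0 ∷_) incrementHead (compositions (suc i) k) (compositions i (suc k)) ⟩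
  length (compositions (suc i) k) + length (compositions i (suc k))
    ≡⟨ cong₂ _+_ (length-compositions (suc i) k) (length-compositions i (suc k)) ⟩
  (suc i + k) C suc i + (i + suc k) C i
    ≡⟨ cong (λ m → m C suc i + (i + suc k) C i) (sym (+-suc i k)) ⟩
  (i + suc k) C suc i + (i + suc k) C i
    ≡⟨ +-comm ((i + suc k) C suc i) _ ⟩
  (i + suc k) C i + (i + suc k) C suc i
    ≡⟨ nCk+nC[k+1]≡[n+1]C[k+1] (i + suc k) i ⟩
  (suc i + suc k) C suc i
    ∎
  where open ≡-Reasoning

IsComposition : ℕ → ℕ → List ℕ → Set
IsComposition i k c = length c ≡ suc k × sum c ≡ i

compositions-sound : ∀ i k → All (IsComposition i k) (compositions i k)
compositions-sound i       zero    = (refl , +-identityʳ i) ∷ []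
compositions-sound zero    (suc k) =
  All.map⁺ (All.map (λ (l , s) → cong suc l , s) (compositions-sound zero k))
compositions-sound (suc i) (suc k) = All.++⁺
  (All.map⁺ (All.map (λ (l , s) → cong suc l , s) (compositions-sound (suc i) k)))
  (All.map⁺ (All.map (λ {c} → incrementHead-sound {c}) (compositions-sound i (suc k))))
  where
  incrementHead-sound : ∀ {c} → IsComposition i (suc k) c → IsComposition (suc i) (suc k) (incrementHead c)
  incrementHead-sound {_ ∷ _} (l , s) = l , cong suc s

compositions-unique : ∀ i k → Unique (compositions i k)
compositions-unique i       zero    = [] ∷ []
compositions-unique zero    (suc k) = Unique.map⁺ List.∷-injectiveʳ (compositions-unique zero k)
compositions-unique (suc i) (suc k) = Unique.++⁺
  (Unique.map⁺ List.∷-injectiveʳ (compositions-unique (suc i) k))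
  (Unique.map⁺ incrementHead-injective (compositions-unique i (suc k)))
  (map-disjoint 0∷≢incrementHead)
  where
  incrementHead-injective : ∀ {c d} → incrementHead c ≡ incrementHead d → c ≡ d
  incrementHead-injective {[]}    {[]}    _    = refl
  incrementHead-injective {_ ∷ _} {_ ∷ _} refl = refl
  0∷≢incrementHead : ∀ c d → 0 ∷ c ≢ incrementHead d
  0∷≢incrementHead c (_ ∷ _) ()

does-⇔ : ∀ {P Q : Set} → P ⇔ Q → (p : Dec P) (q : Dec Q) → does p ≡ does q
does-⇔ P⇔Q p (yes q) = dec-true p (Equivalence.from P⇔Q q)
does-⇔ P⇔Q p (no ¬q) = dec-false p (¬q ∘ Equivalence.to P⇔Q)

indicator : Bool → ℕ
indicator b = if b then 1 else 0

_≟ₛ_ : DecidableEquality (Subset r)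
_≟ₛ_ = ≡-dec Bool._≟_

row : BipGraph n r → Fin n → Subset r
row G x = tabulate (G x)

inConnDomain? : (G : BipGraph n r) → ∀ x → Dec (InConnDomain G x)
inConnDomain? G x = any? (λ y → G x y Bool.≟ true)

connDomain : BipGraph n r → Subset n
connDomain G = tabulate (λ x → does (inConnDomain? G x))

rowCount : BipGraph n r → Subset r → ℕ
rowCount G t = ∑ (λ x → indicator (does (row G x ≟ₛ t)))

Code : ℕ → Set
Code n = Subset n × List ℕ

_≟ᶜ_ : DecidableEquality (Code n)
_≟ᶜ_ = Product.≡-dec _≟ₛ_ (List.≡-dec ℕ._≟_)

invariant : BipGraph n r → Code n
invariant {r = r} G = connDomain G , map (rowCount G) (nonemptySubsets r)

permute : (Fin r → Fin r) → Subset r → Subset r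
permute p t = tabulate (lookup t ∘ p)

permute-cong : ∀ {p q : Fin r → Fin r} → p ≗ q → ∀ t → permute p t ≡ permute q t
permute-cong p≗q t = tabulate-cong (cong (lookup t) ∘ p≗q)

permute-inverse : ∀ {p q : Fin r → Fin r} → q ∘ p ≗ id → ∀ t → permute p (permute q t) ≡ t
permute-inverse {p = p} {q} q∘p≗id t = begin
  tabulate (lookup (tabulate (lookup t ∘ q)) ∘ p) ≡⟨ tabulate-cong (lookup∘tabulate (lookup t ∘ q) ∘ p) ⟩
  tabulate (lookup t ∘ q ∘ p)                     ≡⟨ tabulate-cong (cong (lookup t) ∘ q∘p≗id) ⟩
  tabulate (lookup t)                             ≡⟨ tabulate∘lookup t ⟩
  t                                               ∎
  where open ≡-Reasoning

LSLEquiv-refl : ∀ {G : BipGraph n r} → LSLEquiv G G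
LSLEquiv-refl = record
  { α = ↔-refl ; β = ↔-refl ; edges = λ _ _ → refl ; domain = λ _ → mk⇔ id id }

LSLEquiv-sym : ∀ {G H : BipGraph n r} → LSLEquiv G H → LSLEquiv H G
LSLEquiv-sym {H = H} E = record
  { α = ↔-sym α
  ; β = ↔-sym β
  ; edges = λ x y → trans (cong₂ H (sym (strictlyInverseˡ α x)) (sym (strictlyInverseˡ β y)))
                          (sym (edges (from α x) (from β y)))
  ; domain = λ x → mk⇔ (Equivalence.from (domain x)) (Equivalence.to (domain x))
  }
  where open LSLEquiv E; open Inverse

module _ {G H : BipGraph n r} (E : LSLEquiv G H) where
  open LSLEquiv E
  open Inverse

  connDomain-LSLEquiv : connDomain G ≡ connDomain H
  connDomain-LSLEquiv = tabulate-cong λ x → does-⇔ (domain x) (inConnDomain? G x) (inConnDomain? H x)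

  row-LSLEquiv : ∀ x → row G x ≡ permute (to β) (row H (to α x))
  row-LSLEquiv x = tabulate-cong λ y → trans (edges x y) (sym (lookup∘tabulate (H (to α x)) (to β y)))

  rowCount-LSLEquiv : ∀ t → rowCount H t ≡ rowCount G (permute (to β) t)
  rowCount-LSLEquiv t = trans (sum-permute (λ z → indicator (does (row H z ≟ₛ t))) α)
    (sum-cong-≗ λ x → cong indicator (does-⇔ (rows⇔ x) (row H (to α x) ≟ₛ t) (row G x ≟ₛ permute (to β) t)))
    where
    rows⇔ : ∀ x → (row H (to α x) ≡ t) ⇔ (row G x ≡ permute (to β) t)
    rows⇔ x = mk⇔ (λ eq → trans (row-LSLEquiv x) (cong (permute (to β)) eq))
      (λ eq → begin
        row H (to α x)                                     ≡⟨ permute-inverse (strictlyInverseˡ β) _ ⟨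
        permute (from β) (permute (to β) (row H (to α x))) ≡⟨ cong (permute (from β)) (row-LSLEquiv x) ⟨
        permute (from β) (row G x)                         ≡⟨ cong (permute (from β)) eq ⟩
        permute (from β) (permute (to β) t)                ≡⟨ permute-inverse (strictlyInverseˡ β) t ⟩
        t                                                  ∎)
      where open ≡-Reasoning

graphFromRows : Vec (Subset r) n → BipGraph n r
graphFromRows rows x y = lookup (lookup rows x) y

multiplicity : Subset r → List (Subset r) → ℕ
multiplicity t []       = 0
multiplicity t (u ∷ us) = indicator (does (u ≟ₛ t)) + multiplicity t us

rowCount-graphFromRows : ∀ (rows : Vec (Subset r) n) t →
  rowCount (graphFromRows rows) t ≡ multiplicity t (toList rows)
rowCount-graphFromRows []       t = refl
rowCount-graphFromRows (v ∷ vs) t =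
  cong₂ _+_ (cong (λ w → indicator (does (w ≟ₛ t))) (tabulate∘lookup v)) (rowCount-graphFromRows vs t)

connDomain-graphFromRows : ∀ (rows : Vec (Subset r) n) →
  connDomain (graphFromRows rows) ≡ Vec.map (does ∘ nonempty?) rows
connDomain-graphFromRows []       = refl
connDomain-graphFromRows (v ∷ vs) =
  cong₂ _∷_ (does-⇔ nonempty⇔ (inConnDomain? (graphFromRows (v ∷ vs)) zero) (nonempty? v))
            (connDomain-graphFromRows vs)
  where
  nonempty⇔ : InConnDomain (graphFromRows (v ∷ vs)) zero ⇔ Nonempty v
  nonempty⇔ = mk⇔ (λ (y , eq) → y , lookup⇒[]= y v eq) (λ (y , y∈v) → y , []=⇒lookup y∈v)

multiplicity-++ : ∀ (t : Subset r) xs ys → multiplicity t (xs ++ ys) ≡ multiplicity t xs + multiplicity t ys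
multiplicity-++ t []       ys = refl
multiplicity-++ t (u ∷ xs) ys =
  trans (cong (λ m → indicator (does (u ≟ₛ t)) + m) (multiplicity-++ t xs ys))
        (sym (+-assoc (indicator (does (u ≟ₛ t))) (multiplicity t xs) (multiplicity t ys)))

multiplicity-replicate-self : ∀ (t : Subset r) a → multiplicity t (replicate a t) ≡ a
multiplicity-replicate-self t zero    = refl
multiplicity-replicate-self t (suc a) =
  cong₂ _+_ (cong indicator (dec-true (t ≟ₛ t) refl)) (multiplicity-replicate-self t a)

multiplicity-replicate-other : ∀ {t u : Subset r} → u ≢ t → ∀ a → multiplicity t (replicate a u) ≡ 0
multiplicity-replicate-other         u≢t zero    = refl
multiplicity-replicate-other {t = t} {u} u≢t (suc a) =
  cong₂ _+_ (cong indicator (dec-false (u ≟ₛ t) u≢t)) (multiplicity-replicate-other u≢t a)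

fillRows : Subset n → List (Subset r) → Vec (Subset r) n
fillRows []            L       = []
fillRows (outside ∷ S) L       = ∅ ∷ fillRows S L
fillRows (inside  ∷ S) []      = ∅ ∷ fillRows S []
fillRows (inside  ∷ S) (t ∷ L) = t ∷ fillRows S L

∅-empty : ¬ Nonempty (∅ {r})
∅-empty (_ , y∈∅) = ∉⊥ y∈∅

multiplicity-fillRows : ∀ {t : Subset r} → Nonempty t → ∀ (S : Subset n) L → ∣ S ∣ ≡ length L →
  multiplicity t (toList (fillRows S L)) ≡ multiplicity t L
multiplicity-fillRows t≢∅ []            []      _ = refl
multiplicity-fillRows {t = t} t≢∅ (outside ∷ S) L  eq =
  cong₂ _+_ (cong indicator (dec-false (∅ ≟ₛ t) λ ∅≡t → ∅-empty (subst Nonempty (sym ∅≡t) t≢∅)))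
            (multiplicity-fillRows t≢∅ S L eq)
multiplicity-fillRows t≢∅ (inside ∷ S)  (u ∷ L) eq =
  cong (λ m → indicator (does (u ≟ₛ _)) + m) (multiplicity-fillRows t≢∅ S L (suc-injective eq))

domain-fillRows : ∀ (S : Subset n) (L : List (Subset r)) → All Nonempty L → ∣ S ∣ ≡ length L →
  Vec.map (does ∘ nonempty?) (fillRows S L) ≡ S
domain-fillRows []            []      _            _  = refl
domain-fillRows {r = r} (outside ∷ S) L L≢∅ eq =
  cong₂ _∷_ (dec-false (nonempty? {r} ∅) ∅-empty) (domain-fillRows S L L≢∅ eq)
domain-fillRows (inside ∷ S)  (t ∷ L) (t≢∅ ∷ L≢∅) eq =
  cong₂ _∷_ (dec-true (nonempty? t) t≢∅) (domain-fillRows S L L≢∅ (suc-injective eq))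

expand : List (Subset r) → List ℕ → List (Subset r)
expand []       _        = []
expand (t ∷ ts) []       = []
expand (t ∷ ts) (a ∷ as) = replicate a t ++ expand ts as

length-expand : ∀ (ts : List (Subset r)) c → length c ≡ length ts → length (expand ts c) ≡ sum c
length-expand []       []       _  = refl
length-expand (t ∷ ts) (a ∷ as) eq =
  trans (length-++ (replicate a t))
        (cong₂ _+_ (length-replicate a) (length-expand ts as (suc-injective eq)))

expand-nonempty : ∀ {ts : List (Subset r)} → All Nonempty ts → ∀ c → All Nonempty (expand ts c)
expand-nonempty []             _        = []
expand-nonempty (_ ∷ _)        []       = []
expand-nonempty (t≢∅ ∷ ts≢∅) (a ∷ as) = All.++⁺ (All.replicate⁺ a t≢∅) (expand-nonempty ts≢∅ as)

multiplicity-expand-other : ∀ {t : Subset r} {ts} → All (_≢ t) ts → ∀ c → multiplicity t (expand ts c) ≡ 0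
multiplicity-expand-other []               _        = refl
multiplicity-expand-other (_ ∷ _)          []       = refl
multiplicity-expand-other {t = t} {u ∷ ts} (u≢t ∷ ts≢t) (a ∷ as) =
  trans (multiplicity-++ t (replicate a u) (expand ts as))
        (cong₂ _+_ (multiplicity-replicate-other u≢t a) (multiplicity-expand-other ts≢t as))

multiplicities-expand : ∀ {ts : List (Subset r)} → Unique ts → ∀ c → length c ≡ length ts →
  map (λ t → multiplicity t (expand ts c)) ts ≡ c
multiplicities-expand []                    []       _  = refl
multiplicities-expand {ts = t ∷ ts} (t∉ts ∷ uniq) (a ∷ as) eq = cong₂ _∷_ head-count tail-counts
  where
  head-count : multiplicity t (replicate a t ++ expand ts as) ≡ a
  head-count = begin
    multiplicity t (replicate a t ++ expand ts as)
      ≡⟨ multiplicity-++ t (replicate a t) _ ⟩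
    multiplicity t (replicate a t) + multiplicity t (expand ts as)
      ≡⟨ cong₂ _+_ (multiplicity-replicate-self t a) (multiplicity-expand-other (All.map (_∘ sym) t∉ts) as) ⟩
    a + 0
      ≡⟨ +-identityʳ a ⟩
    a
      ∎
    where open ≡-Reasoning
  tail-counts : map (λ u → multiplicity u (replicate a t ++ expand ts as)) ts ≡ as
  tail-counts = trans
    (map-cong-local (All.map (λ {u} t≢u → trans (multiplicity-++ u (replicate a t) (expand ts as))
                                                 (cong (_+ _) (multiplicity-replicate-other t≢u a))) t∉ts))
    (multiplicities-expand uniq as (suc-injective eq))

graphOf : Code n → BipGraph n r
graphOf {r = r} (S , c) = graphFromRows (fillRows S (expand (nonemptySubsets r) c))

invariant-graphOf : ∀ {k} → length (nonemptySubsets r) ≡ suc k →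
  ∀ (S : Subset n) c → IsComposition ∣ S ∣ k c → invariant (graphOf {r = r} (S , c)) ≡ (S , c)
invariant-graphOf {r = r} parts S c (length-c , ∑c≡∣S∣) = cong₂ _,_ domain counts
  where
  L = expand (nonemptySubsets r) c
  length-c′ : length c ≡ length (nonemptySubsets r)
  length-c′ = trans length-c (sym parts)
  ∣S∣≡length-L : ∣ S ∣ ≡ length L
  ∣S∣≡length-L = trans (sym ∑c≡∣S∣) (sym (length-expand (nonemptySubsets r) c length-c′))
  domain : connDomain (graphOf {r = r} (S , c)) ≡ S
  domain = trans (connDomain-graphFromRows (fillRows S L))
                 (domain-fillRows S L (expand-nonempty (nonemptySubsets-nonempty r) c) ∣S∣≡length-L)
  counts : map (rowCount (graphOf {r = r} (S , c))) (nonemptySubsets r) ≡ c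
  counts = trans
    (map-cong-local (All.map (λ {t} t≢∅ → trans (rowCount-graphFromRows (fillRows S L) t)
                                                (multiplicity-fillRows t≢∅ S L ∣S∣≡length-L))
                             (nonemptySubsets-nonempty r)))
    (multiplicities-expand (nonemptySubsets-unique r) c length-c′)

relabelledInvariant : BipGraph n r → (Fin r → Fin r) → Code n
relabelledInvariant {r = r} G p = connDomain G , map (rowCount G ∘ permute p) (nonemptySubsets r)

orbit : BipGraph n r → List (Code n)
orbit {r = r} G = map (relabelledInvariant G) (perms r)

length-orbit : ∀ (G : BipGraph n r) → length (orbit G) ≡ r !
length-orbit {r = r} G = trans (length-map (relabelledInvariant G) (perms r)) (length-perms r)

relabelledInvariant-LSLEquiv : ∀ {G H : BipGraph n r} (E : LSLEquiv G H) {p} →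
  p ≗ Inverse.to (LSLEquiv.β E) → invariant H ≡ relabelledInvariant G p
relabelledInvariant-LSLEquiv {r = r} {G} E p≗β = cong₂ _,_ (sym (connDomain-LSLEquiv E))
  (map-cong-local (All.universal (λ t → trans (rowCount-LSLEquiv E t)
                                              (cong (rowCount G) (sym (permute-cong p≗β t))))
                                 (nonemptySubsets r)))

invariant-∈-orbit : ∀ {G H : BipGraph n r} → LSLEquiv G H → invariant H ∈ orbit G
invariant-∈-orbit {G = G} E
  with p , p∈perms , p≗β ← perms-complete (Inverse.to (LSLEquiv.β E))
                                          (Injection.injective (Inverse⇒Injection (LSLEquiv.β E))) =
  subst (_∈ orbit G) (sym (relabelledInvariant-LSLEquiv E p≗β)) (∈-map⁺ (relabelledInvariant G) p∈perms)

emptyGraph : BipGraph n r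
emptyGraph _ _ = false

connDomain-emptyGraph : connDomain (emptyGraph {n} {r}) ≡ ∅
connDomain-emptyGraph {zero}      = refl
connDomain-emptyGraph {suc n} {r} =
  cong₂ _∷_ (dec-false (inConnDomain? (emptyGraph {suc n} {r}) zero) λ ()) (connDomain-emptyGraph {n} {r})

codesOfSize : ∀ n k i → List (Code n)
codesOfSize n k i = cartesianProduct (subsetsOfSize n i) (compositions i k)

candidates : ∀ n k → ℕ → List (Code n)
candidates n k zero    = []
candidates n k (suc m) = candidates n k m ++ codesOfSize n k (suc m)

length-candidates : ∀ n r m → length (candidates n (2 ^ r ∸ 2) m) ≡ sumB n r m
length-candidates n r zero    = refl
length-candidates n r (suc m) = trans (List.length-++ (candidates n k m))
  (cong₂ _+_ (length-candidates n r m)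
             (trans (length-cartesianProductWith _,_ (subsetsOfSize n (suc m)) (compositions (suc m) k))
                    (cong₂ _*_ (length-subsetsOfSize n (suc m)) (length-compositions (suc m) k))))
  where k = 2 ^ r ∸ 2

codesOfSize-sound : ∀ n k i → All (λ (S , c) → ∣ S ∣ ≡ i × IsComposition i k c) (codesOfSize n k i)
codesOfSize-sound n k i = All.tabulate λ e∈ →
  let S∈ , c∈ = ∈-cartesianProduct⁻ (subsetsOfSize n i) (compositions i k) e∈
  in All.lookup (∣∣-subsetsOfSize n i) S∈ , All.lookup (compositions-sound i k) c∈

candidates-sizes : ∀ n k m → All (λ (S , _) → 1 ≤ ∣ S ∣ × ∣ S ∣ ≤ m) (candidates n k m)
candidates-sizes n k zero    = []
candidates-sizes n k (suc m) = All.++⁺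
  (All.map (λ (1≤∣S∣ , ∣S∣≤m) → 1≤∣S∣ , ℕ.m≤n⇒m≤1+n ∣S∣≤m) (candidates-sizes n k m))
  (All.map (λ (∣S∣≡1+m , _) → subst (1 ≤_) (sym ∣S∣≡1+m) (s≤s z≤n) , ≤-reflexive ∣S∣≡1+m)
           (codesOfSize-sound n k (suc m)))

candidates-compositions : ∀ n k m → All (λ (S , c) → IsComposition ∣ S ∣ k c) (candidates n k m)
candidates-compositions n k zero    = []
candidates-compositions n k (suc m) = All.++⁺ (candidates-compositions n k m)
  (All.map (λ {(_ , c)} (∣S∣≡1+m , c-comp) → subst (λ i → IsComposition i k c) (sym ∣S∣≡1+m) c-comp)
           (codesOfSize-sound n k (suc m)))

candidates-unique : ∀ n k m → Unique (candidates n k m)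
candidates-unique n k zero    = []
candidates-unique n k (suc m) = Unique.++⁺ (candidates-unique n k m)
  (Unique.cartesianProduct⁺ (subsetsOfSize-unique n (suc m)) (compositions-unique (suc m) k))
  (All-disjoint (All.map proj₂ (candidates-sizes n k m))
                (All.map (λ (∣S∣≡1+m , _) ∣S∣≤m → 1+n≰n (subst (_≤ m) ∣S∣≡1+m ∣S∣≤m))
                         (codesOfSize-sound n k (suc m))))

1+[a/q]≤ᵘ1+g : ∀ a d g → a ≤ suc d * g → mkℚᵘ (+ 1) 0 ℚᵘ.+ mkℚᵘ (+ a) d ℚᵘ.≤ mkℚᵘ (+ suc g) 0
1+[a/q]≤ᵘ1+g a d g a≤qg = *≤* (subst₂ ℤ._≤_ (sym lhs) (sym rhs) (+≤+ cross))
  where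
  lhs : (+ 1 ℤ.* + suc d ℤ.+ + a ℤ.* + 1) ℤ.* + 1 ≡ + (suc d + a)
  lhs = trans (ℤ.*-identityʳ _) (cong₂ ℤ._+_ (ℤ.*-identityˡ (+ suc d)) (ℤ.*-identityʳ (+ a)))
  rhs : + suc g ℤ.* + suc (d + 0 * suc d) ≡ + (suc g * suc d)
  rhs = trans (cong (λ m → + suc g ℤ.* + suc m) (ℕ.+-identityʳ d)) (sym (ℤ.pos-* (suc g) (suc d)))
  cross : suc d + a ≤ suc g * suc d
  cross = ℕ.≤-trans (+-monoʳ-≤ (suc d) a≤qg)
                    (≤-reflexive (trans (sym (*-suc (suc d) g)) (*-comm (suc d) (suc g))))

1+[a/q]≤1+g : ∀ a q g .{{_ : NonZero q}} → a ≤ q * g → 1ℚ ℚ.+ (+ a / q) ℚ.≤ (+ suc g / 1)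
1+[a/q]≤1+g a (suc d) g a≤qg = ℚ.toℚᵘ-cancel-≤ (begin
  toℚᵘ (1ℚ ℚ.+ (+ a / suc d))                 ≃⟨ ℚ.toℚᵘ-homo-+ 1ℚ (+ a / suc d) ⟩
  toℚᵘ 1ℚ ℚᵘ.+ toℚᵘ (+ a / suc d)              ≃⟨ ℚᵘ.+-cong (ℚ.toℚᵘ-fromℚᵘ (mkℚᵘ (+ 1) 0))
                                                              (ℚ.toℚᵘ-fromℚᵘ (mkℚᵘ (+ a) d)) ⟩
  mkℚᵘ (+ 1) 0 ℚᵘ.+ mkℚᵘ (+ a) d              ≤⟨ 1+[a/q]≤ᵘ1+g a d g a≤qg ⟩
  mkℚᵘ (+ suc g) 0                            ≃⟨ ℚ.toℚᵘ-fromℚᵘ (mkℚᵘ (+ suc g) 0) ⟨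
  toℚᵘ (+ suc g / 1)                          ∎)
  where open ℚᵘ.≤-Reasoning

inequivalent⇒AtLeastClasses : ∀ {n r} (Gs : List (BipGraph n r)) →
  AllPairs (λ G H → ¬ LSLEquiv G H) Gs → AtLeastClasses n r (length Gs)
inequivalent⇒AtLeastClasses Gs pairwise = List.lookup Gs , AllPairs-lookup-injective LSLEquiv-sym pairwise

invariant-candidates : ∀ {r k} → length (nonemptySubsets r) ≡ suc k →
  ∀ n m → All (λ e → invariant (graphOf {r = r} e) ≡ e) (candidates n k m)
invariant-candidates {k = k} parts n m =
  All.map (λ {(S , c)} → invariant-graphOf parts S c) (candidates-compositions n k m)

emptyGraph-≁-candidates : ∀ {r k} → length (nonemptySubsets r) ≡ suc k →
  ∀ n m → All (λ e → ¬ LSLEquiv (emptyGraph {n} {r}) (graphOf e)) (candidates n k m)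
emptyGraph-≁-candidates {r} {k} parts n m = All.zipWith
  (λ { {S , c} ((1≤∣S∣ , _) , invariant-e) E → 1+n≰n (subst (1 ≤_) (∣S∣≡0 S c invariant-e E) 1≤∣S∣) })
  (candidates-sizes n k m , invariant-candidates parts n m)
  where
  ∣S∣≡0 : ∀ S c → invariant (graphOf {r = r} (S , c)) ≡ (S , c) →
    LSLEquiv (emptyGraph {n} {r}) (graphOf (S , c)) → ∣ S ∣ ≡ 0
  ∣S∣≡0 S c invariant-e E = begin
    ∣ S ∣                                    ≡⟨ cong (∣_∣ ∘ proj₁) invariant-e ⟨
    ∣ connDomain (graphOf {r = r} (S , c)) ∣ ≡⟨ cong ∣_∣ (connDomain-LSLEquiv E) ⟨
    ∣ connDomain (emptyGraph {n} {r}) ∣      ≡⟨ cong ∣_∣ (connDomain-emptyGraph {n} {r}) ⟩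
    ∣ ∅ {n} ∣                                ≡⟨ ∣⊥∣≡0 n ⟩
    0                                        ∎
    where open ≡-Reasoning

candidates-inequivalent : ∀ {n r k} → length (nonemptySubsets r) ≡ suc k →
  ∃[ m ] AtLeastClasses n r (suc m) × length (candidates n k n) ≤ r ! * m
candidates-inequivalent {n} {r} {k} parts =
  length zs , subst (AtLeastClasses n r ∘ suc) (List.length-map graphOf zs) classes , count
  where
  Y = candidates n k n
  open GreedyCover _≟ᶜ_ (invariant ∘ graphOf {r = r}) (orbit ∘ graphOf {r = r})
  zs = select Y
  classes : AtLeastClasses n r (length (emptyGraph ∷ map graphOf zs))
  classes = inequivalent⇒AtLeastClasses (emptyGraph ∷ map graphOf zs)
    (All.map⁺ (All.tabulate (All.lookup (emptyGraph-≁-candidates parts n n) ∘ select-⊆ Y))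
     ∷ AllPairs.map⁺ (AllPairs.map (λ separated E → separated (invariant-∈-orbit (LSLEquiv-sym E)))
                                   (select-separated Y)))
  count : length Y ≤ r ! * length zs
  count = length≤*length-select (λ e → invariant-∈-orbit (LSLEquiv-refl {G = graphOf {r = r} e}))
                                (λ e → ≤-reflexive (length-orbit (graphOf {r = r} e))) Y
    (subst Unique (sym (List.map-id-local (invariant-candidates parts n n))) (candidates-unique n k n))

theorem2 : (n r : ℕ) → 1 ≤ n → 1 ≤ r →
    ∃[ m ] (AtLeastClasses n r m × boundB n r ℚ.≤ (+ m / 1))
theorem2 n r@(suc r′) _ (s≤s _)
  with m , classes , count ← candidates-inequivalent {n} (length-nonemptySubsets-suc r′) =
  suc m , classes ,
  1+[a/q]≤1+g (sumB n r n) (r !) m {{r !≢0}} (subst (_≤ r ! * m) (length-candidates n r n) count)
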